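{- Let $(a_n)_{n\in\mathbf{N}}$ be any sequence in $\mathcal{C}$ and $pl=pl_a$ its palindromic length sequence. Then for all $k\ge0$: $pl(4k+1)\ge pl(4k+3)+1$, $pl(4k+2)\ge pl(4k+3)+1$, and $pl(4k)\ge pl(4k+3)$.
   Context: A word is a palindrome if it equals its reversal; $|w|_{pal}$ is the least number of palindromes whose concatenation is $w$. For a sequence $(a_n)$, $pl_a(n)=|a_0a_1\cdots a_n|_{pal}$ (palindromic length of the prefix of length $n+1$). The class $\mathcal{C}$: let $\Sigma$ be an alphabet with at least two letters and $a\in\Sigma$. For a bijection $g$ of $\Sigma$ and a word $u$, $g(u)$ is the letter-by-letter image. Let $(f_n)_{n\ge0}$ be bijections of $\Sigma$ and define $w_0=a$, $w_n=w_{n-1}f_{n-1}(w_{n-1})f_{n-1}(w_{n-1})w_{n-1}$ for $n>0$, with the requirement $f_n(w_n)\neq w_n$ for all $n\ge0$. The limit infinite sequence is in $\mathcal{C}$; $\mathcal{C}$ is the set of all such limits. -}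

module Defs where

open import Data.Nat using (ℕ; zero; suc; _+_; _≤_)
open import Data.List using (List; []; _∷_; _++_; reverse; map)
open import Data.Product using (_×_; Σ; ∃)
open import Relation.Binary.PropositionalEquality using (_≡_; _≢_)
open import Function.Bundles using (_↔_; Inverse)

IsPalindrome : {A : Set} → List A → Set
IsPalindrome w = reverse w ≡ w

data PalFactorization {A : Set} : List A → ℕ → Set where
  pf-nil  : PalFactorization [] 0
  pf-cons : ∀ {p w k} → IsPalindrome p →
            PalFactorization w k → PalFactorization (p ++ w) (suc k)

IsPalLength : {A : Set} → List A → ℕ → Set
IsPalLength w k = PalFactorization w k × (∀ j → PalFactorization w j → k ≤ j)

applyBij : {A : Set} → (A ↔ A) → List A → List A
applyBij g u = map (Inverse.to g) u

wordSeq : {A : Set} → A → (ℕ → A ↔ A) → ℕ → List A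
wordSeq a f zero = a ∷ []
wordSeq a f (suc n) =
  wordSeq a f n ++ applyBij (f n) (wordSeq a f n)
    ++ applyBij (f n) (wordSeq a f n) ++ wordSeq a f n

prefix : {A : Set} → (ℕ → A) → ℕ → List A
prefix s zero = []
prefix s (suc n) = prefix s n ++ (s n ∷ [])

-- s is the limit of the words w_n: every w_n is a prefix of s
-- (the lengths |w_n| = 4^n are unbounded, so this determines s)
IsLimit : {A : Set} → (ℕ → List A) → (ℕ → A) → Set
IsLimit w s = ∀ n → prefix s (Data.List.length (w n)) ≡ w n

InClassC : (A : Set) → (ℕ → A) → Set
InClassC A s =
  Σ A λ a → Σ (ℕ → A ↔ A) λ f →
    (∀ n → applyBij (f n) (wordSeq a f n) ≢ wordSeq a f n) ×
    IsLimit (wordSeq a f) s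

-- pl_s(n) = |s_0 ... s_n|_pal, given relationally
IsPl : {A : Set} → (ℕ → A) → ℕ → ℕ → Set
IsPl s n k = IsPalLength (prefix s (suc n)) k

-- A sequence of 𝒞 is a concatenation of blocks x y y x with x ≠ y: w₁ is such a
-- block, and the letter-by-letter image of a block under a bijection is again one.
-- In such a sequence two equal neighbours s c = s (c + 1) only occur for odd c, and
-- no factor of odd length ≥ 5 is a palindrome.  Hence a palindromic factor has
-- length 0, 1 or 3, or has even length and is centred at an even position.
-- Looking at the last factor of a palindromic factorization of the prefix of length
-- 4k + r (r = 1, 2, 3) one can then exchange it, by a simultaneous induction, for a
-- factorization with strictly fewer factors of the prefix of length 4k or 4k + 4:
-- letters and length-3 factors are absorbed into a neighbouring block, and an even
-- palindrome is trimmed or widened to the nearest block boundaries.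

module Submission where

open import Defs
open import Data.Nat using (ℕ; _+_; _*_; _≤_)
open import Data.Product using (_×_; ∃₂)
open import Relation.Binary.PropositionalEquality using (_≢_)

open import Data.Nat using (zero; suc; _<_; _∸_; z≤n; s≤s)
open import Data.Nat.Properties
open import Data.Nat.Tactic.RingSolver using (solve)
open import Data.List using (List; []; _∷_; _++_; _∷ʳ_; reverse; map; length)
open import Data.List.Properties
  using (++-assoc; ++-identityʳ; ∷-injective; ∷ʳ-injective; reverse-++; unfold-reverse; length-++; length-map)
open import Data.Product using (∃-syntax; _,_)
open import Data.Sum using (inj₁; inj₂)
open import Data.Empty using (⊥-elim)
open import Function.Bundles using (_↔_; Inverse; Injection)
open import Function.Properties.Inverse using (↔⇒↣)
open import Relation.Binary.PropositionalEquality
  using (_≡_; refl; sym; trans; cong; cong₂; subst; subst₂; module ≡-Reasoning)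

private variable
  A : Set
  s : ℕ → A
  x y : A
  u v w : List A
  i n L m k q : ℕ

data Parity : ℕ → Set where
  even : ∀ h → Parity (h + h)
  odd  : ∀ h → Parity (suc (h + h))

parity : ∀ n → Parity n
parity zero = even 0
parity (suc n) with parity n
... | even h = odd h
... | odd h  = subst Parity (cong suc (+-suc h h)) (even (suc h))

data Mod4 : ℕ → Set where
  rem₀ : ∀ q → Mod4 (q * 4)
  rem₁ : ∀ q → Mod4 (1 + q * 4)
  rem₂ : ∀ q → Mod4 (2 + q * 4)
  rem₃ : ∀ q → Mod4 (3 + q * 4)

mod4 : ∀ n → Mod4 n
mod4 zero = rem₀ 0
mod4 (suc n) with mod4 n
... | rem₀ q = rem₁ q
... | rem₁ q = rem₂ q
... | rem₂ q = rem₃ q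
... | rem₃ q = rem₀ (suc q)

block-index-< : ∀ {ρ r j k} → r < ρ → ρ + j * 4 ≤ r + k * 4 → j < k
block-index-< {ρ} {r} {j} {k} r<ρ le = ≰⇒> λ k≤j →
  <⇒≱ (+-monoˡ-< (k * 4) r<ρ) (≤-trans (+-monoʳ-≤ ρ (*-monoˡ-≤ 4 k≤j)) le)

block-index-≤ : ∀ {ρ r j k} → j < k → ρ ≤ 4 + r → ρ + j * 4 ≤ r + k * 4
block-index-≤ {ρ} {r} {j} {k} j<k ρ≤4+r = begin
  ρ + j * 4        ≤⟨ +-monoˡ-≤ (j * 4) ρ≤4+r ⟩
  4 + r + j * 4    ≡⟨ solve (r ∷ j ∷ []) ⟩
  r + suc j * 4    ≤⟨ +-monoʳ-≤ r (*-monoˡ-≤ 4 j<k) ⟩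
  r + k * 4        ∎
  where open ≤-Reasoning

balanced-start : ∀ r {i k h} → i + (r + k * 4) ≡ h * 4 → r + i ≡ (h ∸ k) * 4
balanced-start r {i} {k} {h} eq = begin
  r + i                ≡⟨ sym (m+n∸n≡m (r + i) (k * 4)) ⟩
  r + i + k * 4 ∸ k * 4 ≡⟨ cong (_∸ k * 4) (solve (r ∷ i ∷ k ∷ [])) ⟩
  i + (r + k * 4) ∸ k * 4 ≡⟨ cong (_∸ k * 4) eq ⟩
  h * 4 ∸ k * 4        ≡⟨ sym (*-distribʳ-∸ 4 h k) ⟩
  (h ∸ k) * 4          ∎
  where open ≡-Reasoning

-- The factor s i ⋯ s (n ∸ 1) is a palindrome, stated through its mirror symmetry.
PalFactor : (ℕ → A) → ℕ → ℕ → Set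
PalFactor s i n = ∀ {a b} → i ≤ a → i ≤ b → suc (a + b) ≡ i + n → s a ≡ s b

PalFactor-vacuous : n ≤ i → PalFactor s i n
PalFactor-vacuous n≤i i≤a i≤b eq = ⊥-elim (<⇒≱ (≤-reflexive eq) (+-mono-≤ i≤a (≤-trans n≤i i≤b)))

trim : PalFactor s i (suc n) → PalFactor s (suc i) n
trim {i = i} {n} pal i<a i<b eq = pal (<⇒≤ i<a) (<⇒≤ i<b) (trans eq (sym (+-suc i n)))

mirror-of-first : suc (i + k) ≡ i + suc n → k ≡ n
mirror-of-first {i} {k} eq = suc-injective (+-cancelˡ-≡ i _ _ (trans (+-suc i k) eq))

widen : PalFactor s (suc i) n → s i ≡ s n → PalFactor s i (suc n)
widen {s = s} {i} {n} pal ends {a} {b} i≤a i≤b eq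
  with m≤n⇒m<n∨m≡n i≤a | m≤n⇒m<n∨m≡n i≤b
... | inj₂ refl | _         = trans ends (cong s (sym (mirror-of-first eq)))
... | inj₁ _    | inj₂ refl = sym (trans ends (cong s (sym (mirror-of-first (trans (cong suc (+-comm i a)) eq)))))
... | inj₁ i<a  | inj₁ i<b  = pal i<a i<b (trans eq (+-suc i n))

record IsBlock (s : ℕ → A) (p : ℕ) : Set where
  field
    outer    : s p ≡ s (3 + p)
    inner    : s (1 + p) ≡ s (2 + p)
    distinct : s p ≢ s (1 + p)

IsBlock⇒PalFactor : IsBlock s i → PalFactor s i (4 + i)
IsBlock⇒PalFactor b = widen (widen (PalFactor-vacuous ≤-refl) inner) outer
  where open IsBlock b

segment : (ℕ → A) → ℕ → ℕ → List A
segment s i zero    = []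
segment s i (suc L) = s i ∷ segment s (suc i) L

segment-∷ʳ : ∀ i L → segment s i L ∷ʳ s (i + L) ≡ segment s i (suc L)
segment-∷ʳ {s = s} i zero = cong (λ j → s j ∷ []) (+-identityʳ i)
segment-∷ʳ {s = s} i (suc L) =
  cong (s i ∷_) (trans (cong (λ j → segment s (suc i) L ∷ʳ s j) (+-suc i L)) (segment-∷ʳ (suc i) L))

prefix-segment : ∀ n → prefix s n ≡ segment s 0 n
prefix-segment zero = refl
prefix-segment {s = s} (suc n) = trans (cong (_∷ʳ s n) (prefix-segment n)) (segment-∷ʳ 0 n)

segment-++ : ∀ i a b → segment s i a ++ segment s (i + a) b ≡ segment s i (a + b)
segment-++ {s = s} i zero b = cong (λ j → segment s j b) (+-identityʳ i)
segment-++ {s = s} i (suc a) b =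
  cong (s i ∷_) (trans (cong (λ j → segment s (suc i) a ++ segment s j b) (+-suc i a)) (segment-++ (suc i) a b))

++-segment : ∀ u i L → u ++ w ≡ segment s i L →
  ∃[ a ] ∃[ b ] a + b ≡ L × u ≡ segment s i a × w ≡ segment s (i + a) b
++-segment {s = s} [] i L eq = 0 , L , refl , refl , trans eq (cong (λ j → segment s j L) (sym (+-identityʳ i)))
++-segment {s = s} (x ∷ u) i (suc L) eq with ∷-injective eq
... | refl , eq′ with ++-segment u (suc i) L eq′
... | a , b , refl , refl , refl = suc a , b , refl , refl , cong (λ j → segment s j b) (sym (+-suc i a))

reverse-∷-∷ʳ : ∀ (x : A) w y → reverse (x ∷ (w ∷ʳ y)) ≡ y ∷ (reverse w ∷ʳ x)
reverse-∷-∷ʳ x w y = trans (unfold-reverse x (w ∷ʳ y)) (cong (_∷ʳ x) (reverse-++ w (y ∷ [])))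

palindrome-peel : IsPalindrome (x ∷ (w ∷ʳ y)) → x ≡ y × IsPalindrome w
palindrome-peel {x = x} {w} {y} pal with ∷-injective (trans (sym (reverse-∷-∷ʳ x w y)) pal)
... | _ , eq with ∷ʳ-injective (reverse w) w eq
... | rev , x≡y = x≡y , rev

palindrome-wrap : x ≡ y → IsPalindrome w → IsPalindrome (x ∷ (w ∷ʳ y))
palindrome-wrap {x = x} {w = w} refl pal = trans (reverse-∷-∷ʳ x w x) (cong (λ v → x ∷ (v ∷ʳ x)) pal)

segment-peel : ∀ i L → segment s i (2 + L) ≡ s i ∷ (segment s (suc i) L ∷ʳ s (suc i + L))
segment-peel {s = s} i L = cong (s i ∷_) (sym (segment-∷ʳ (suc i) L))

+-suc-suc : ∀ i L → i + suc (suc L) ≡ suc (suc (i + L))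
+-suc-suc i L = trans (+-suc i (suc L)) (cong suc (+-suc i L))

PalFactor⇒IsPalindrome : ∀ i L → PalFactor s i (i + L) → IsPalindrome (segment s i L)
PalFactor⇒IsPalindrome i zero          _   = refl
PalFactor⇒IsPalindrome i (suc zero)    _   = refl
PalFactor⇒IsPalindrome {s = s} i (suc (suc L)) pal =
  subst IsPalindrome (sym (segment-peel i L)) (palindrome-wrap ends (PalFactor⇒IsPalindrome (suc i) L (trim pal′)))
  where
  pal′ : PalFactor s i (suc (suc (i + L)))
  pal′ = subst (PalFactor s i) (+-suc-suc i L) pal
  ends : s i ≡ s (suc i + L)
  ends = pal′ ≤-refl (m≤n⇒m≤1+n (m≤m+n i L)) (sym (+-suc i (suc (i + L))))

IsPalindrome⇒PalFactor : ∀ i L → IsPalindrome (segment s i L) → PalFactor s i (i + L)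
IsPalindrome⇒PalFactor i zero _ = PalFactor-vacuous (≤-reflexive (+-identityʳ i))
IsPalindrome⇒PalFactor {s = s} i (suc zero) _ = subst (PalFactor s i) (+-comm 1 i) (widen (PalFactor-vacuous (n≤1+n i)) refl)
IsPalindrome⇒PalFactor {s = s} i (suc (suc L)) pal with palindrome-peel (subst IsPalindrome (segment-peel i L) pal)
... | ends , inside = subst (PalFactor s i) (sym (+-suc-suc i L)) (widen (IsPalindrome⇒PalFactor (suc i) L inside) ends)

data Factorization (s : ℕ → A) : ℕ → ℕ → Set where
  []   : Factorization s 0 0
  snoc : Factorization s i m → i ≤ n → PalFactor s i n → Factorization s n (suc m)

PalFactorization-++ : PalFactorization u m → PalFactorization v n → PalFactorization (u ++ v) (m + n)
PalFactorization-++ pf-nil q = q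
PalFactorization-++ {v = v} (pf-cons {p} {w} pp r) q =
  subst (λ z → PalFactorization z _) (sym (++-assoc p w v)) (pf-cons pp (PalFactorization-++ r q))

Factorization⇒PalFactorization-segment : Factorization s n m → PalFactorization (segment s 0 n) m
Factorization⇒PalFactorization-segment [] = pf-nil
Factorization⇒PalFactorization-segment {s = s} (snoc {i = i} {m = m} {n = n} f i≤n pal) =
  subst₂ PalFactorization concat (+-comm m 1) (PalFactorization-++ (Factorization⇒PalFactorization-segment f) last)
  where
  concat : segment s 0 i ++ segment s i (n ∸ i) ≡ segment s 0 n
  concat = trans (segment-++ 0 i (n ∸ i)) (cong (segment s 0) (m+[n∸m]≡n i≤n))
  last : PalFactorization (segment s i (n ∸ i)) 1
  last = subst (λ z → PalFactorization z 1) (++-identityʳ _)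
    (pf-cons (PalFactor⇒IsPalindrome i (n ∸ i) (subst (PalFactor s i) (sym (m+[n∸m]≡n i≤n)) pal)) pf-nil)

PalFactorization-segment⇒Factorization : PalFactorization w m → w ≡ segment s i L → Factorization s i k → Factorization s (i + L) (k + m)
PalFactorization-segment⇒Factorization {i = i} {L = zero} {k = k} pf-nil refl f =
  subst₂ (Factorization _) (sym (+-identityʳ i)) (sym (+-identityʳ k)) f
PalFactorization-segment⇒Factorization {s = s} {i = i} {L = L} {k = k} (pf-cons {p} pp rest) eq f with ++-segment p i L eq
... | a , b , refl , refl , eq′ = subst₂ (Factorization s) (+-assoc i a b) (sym (+-suc k _))
  (PalFactorization-segment⇒Factorization rest eq′ (snoc f (m≤m+n i a) (IsPalindrome⇒PalFactor i a pp)))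

PalFactorization⇒Factorization : PalFactorization (prefix s n) m → Factorization s n m
PalFactorization⇒Factorization {n = n} pf = PalFactorization-segment⇒Factorization pf (prefix-segment n) []

Factorization⇒PalFactorization : Factorization s n m → PalFactorization (prefix s n) m
Factorization⇒PalFactorization {n = n} {m = m} f =
  subst (λ w → PalFactorization w m) (sym (prefix-segment n)) (Factorization⇒PalFactorization-segment f)

Factorization< : (ℕ → A) → ℕ → ℕ → Set
Factorization< s n m = ∃[ m′ ] m′ < m × Factorization s n m′

weaken : Factorization< s n m → Factorization< s n (suc m)
weaken (m′ , m′<m , f) = m′ , m<n⇒m<1+n m′<m , f

extend : Factorization< s i m → i ≤ n → PalFactor s i n → Factorization< s n (suc m)
extend (m′ , m′<m , f) i≤n pal = suc m′ , s≤s m′<m , snoc f i≤n pal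

-- centred: i + n ≡ 0 (mod 4), i.e. even length and centre at an even position.
data PalShape (i n : ℕ) : Set where
  empty   : i ≡ n → PalShape i n
  letter  : n ≡ suc i → PalShape i n
  triple  : n ≡ 3 + i → PalShape i n
  centred : ∀ h → i + n ≡ h * 4 → i < n → PalShape i n

module BlockSequence {s : ℕ → A} (blocks : ∀ q → IsBlock s (q * 4)) where

  open module Block q = IsBlock (blocks q)

  equal-neighbours⇒odd : ∀ c → s c ≡ s (suc c) → ∃[ h ] suc c ≡ h + h
  equal-neighbours⇒odd c eq with mod4 c
  ... | rem₀ q = ⊥-elim (distinct q eq)
  ... | rem₁ q = suc (q + q) , solve (q ∷ [])
  ... | rem₂ q = ⊥-elim (distinct q (trans (outer q) (trans (sym eq) (sym (inner q)))))
  ... | rem₃ q = 2 + (q + q) , solve (q ∷ [])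

  length5-not-palindromic : ∀ c → s (suc c) ≡ s (3 + c) → s c ≢ s (4 + c)
  length5-not-palindromic c e₁ e₂ with mod4 c
  ... | rem₀ q = distinct q (trans (outer q) (sym e₁))
  ... | rem₁ q = distinct (suc q) (trans (sym e₁) (trans (sym (inner q)) e₂))
  ... | rem₂ q = distinct q (begin
    s (q * 4)           ≡⟨ outer q ⟩
    s (3 + q * 4)       ≡⟨ e₁ ⟩
    s (1 + suc q * 4)   ≡⟨ inner (suc q) ⟩
    s (2 + suc q * 4)   ≡⟨ sym e₂ ⟩
    s (2 + q * 4)       ≡⟨ sym (inner q) ⟩
    s (1 + q * 4)       ∎)
    where open ≡-Reasoning
  ... | rem₃ q = distinct (suc q) (trans e₁ (sym (inner (suc q))))

  PalFactor-shape : PalFactor s i n → i ≤ n → PalShape i n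
  PalFactor-shape {i} {n} pal i≤n =
    subst (PalShape i) (m∸n+n≡m i≤n) (shape (n ∸ i) (subst (PalFactor s i) (sym (m∸n+n≡m i≤n)) pal))
    where
    shape : ∀ L → PalFactor s i (L + i) → PalShape i (L + i)
    shape L pal with parity L
    ... | even zero = empty refl
    ... | even (suc d) with equal-neighbours⇒odd (d + i) (pal (m≤n+m i d) (m≤n+m i (suc d)) (solve (d ∷ i ∷ [])))
    ...   | h , eq = centred h centre (m<n+m i (s≤s z≤n))
      where
      open ≡-Reasoning
      centre : i + (suc d + suc d + i) ≡ h * 4
      centre = begin
        i + (suc d + suc d + i)     ≡⟨ solve (d ∷ i ∷ []) ⟩
        suc (d + i) + suc (d + i)   ≡⟨ cong₂ _+_ eq eq ⟩
        h + h + (h + h)             ≡⟨ solve (h ∷ []) ⟩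
        h * 4                       ∎
    shape L pal | odd zero = letter refl
    shape L pal | odd (suc zero) = triple refl
    shape L pal | odd (suc (suc d)) = ⊥-elim (length5-not-palindromic (d + i)
      (pal (m≤n+m i (suc d)) (m≤n+m i (3 + d)) (solve (d ∷ i ∷ [])))
      (pal (m≤n+m i d) (m≤n+m i (4 + d)) (solve (d ∷ i ∷ []))))

  -- Unifying the equations of PalFactor-shape with the end r + k * 4 of the last
  -- factor fixes its start; in the centred case balanced-start makes it (4 ∸ r) + j * 4.
  fac₁⇒fac₀ : ∀ k → Factorization s (1 + k * 4) m → Factorization< s (k * 4) m
  fac₂⇒fac₀ : ∀ k → Factorization s (2 + k * 4) m → Factorization< s (k * 4) m
  fac₂⇒fac₄ : ∀ k → Factorization s (2 + k * 4) m → Factorization< s (4 + k * 4) m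
  fac₃⇒fac₄ : ∀ k → Factorization s (3 + k * 4) m → Factorization< s (4 + k * 4) m

  fac₁⇒fac₀ k (snoc f i≤n pal) with PalFactor-shape pal i≤n
  ... | empty refl  = weaken (fac₁⇒fac₀ k f)
  ... | letter refl = _ , ≤-refl , f
  fac₁⇒fac₀ zero    (snoc f i≤n pal) | triple ()
  fac₁⇒fac₀ (suc k) (snoc f i≤n pal) | triple refl = weaken (fac₂⇒fac₄ k f)
  fac₁⇒fac₀ k (snoc f i≤n pal) | centred h e i<n with h ∸ k | balanced-start 1 {k = k} {h = h} e
  ... | suc j | refl = extend (fac₃⇒fac₄ j f) (*-monoˡ-≤ 4 j<k) (trim pal)
    where
    j<k : j < k
    j<k = block-index-< {ρ = 4} (s≤s (s≤s z≤n)) i<n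

  fac₂⇒fac₀ k (snoc f i≤n pal) with PalFactor-shape pal i≤n
  ... | empty refl  = weaken (fac₂⇒fac₀ k f)
  ... | letter refl = weaken (fac₁⇒fac₀ k f)
  fac₂⇒fac₀ zero    (snoc f i≤n pal) | triple ()
  fac₂⇒fac₀ (suc k) (snoc f i≤n pal) | triple refl = weaken (fac₃⇒fac₄ k f)
  fac₂⇒fac₀ k (snoc f i≤n pal) | centred h e i<n with h ∸ k | balanced-start 2 {k = k} {h = h} e
  ... | suc j | refl = extend (fac₂⇒fac₄ j f) (*-monoˡ-≤ 4 j<k) (trim (trim pal))
    where
    j<k : j < k
    j<k = block-index-< {ρ = 3} (s≤s (s≤s (s≤s z≤n))) i<n

  fac₂⇒fac₄ k (snoc f i≤n pal) with PalFactor-shape pal i≤n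
  ... | empty refl  = weaken (fac₂⇒fac₄ k f)
  ... | letter refl = extend (fac₁⇒fac₀ k f) (m≤n+m _ 4) (IsBlock⇒PalFactor (blocks k))
  fac₂⇒fac₄ zero    (snoc f i≤n pal) | triple ()
  fac₂⇒fac₄ (suc k) (snoc f i≤n pal) | triple refl = extend (fac₃⇒fac₄ k f) (m≤n+m _ 4) (IsBlock⇒PalFactor (blocks (suc k)))
  fac₂⇒fac₄ k (snoc f i≤n pal) | centred h e i<n with h ∸ k | balanced-start 2 {k = k} {h = h} e
  ... | suc j | refl = extend (fac₂⇒fac₀ j f) (block-index-≤ j<k z≤n) (widen (widen pal second) first)
    where
    j<k : j < k
    j<k = block-index-< {ρ = 3} (s≤s (s≤s (s≤s z≤n))) i<n
    open ≡-Reasoning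
    second : s (1 + j * 4) ≡ s (2 + k * 4)
    second = begin
      s (1 + j * 4)  ≡⟨ inner j ⟩
      s (2 + j * 4)  ≡⟨ pal ≤-refl (block-index-≤ j<k (s≤s (s≤s z≤n))) (solve (j ∷ k ∷ [])) ⟩
      s (1 + k * 4)  ≡⟨ inner k ⟩
      s (2 + k * 4)  ∎
    first : s (j * 4) ≡ s (3 + k * 4)
    first = begin
      s (j * 4)      ≡⟨ outer j ⟩
      s (3 + j * 4)  ≡⟨ pal (n≤1+n _) (block-index-≤ j<k (s≤s (s≤s z≤n))) (solve (j ∷ k ∷ [])) ⟩
      s (k * 4)      ≡⟨ outer k ⟩
      s (3 + k * 4)  ∎

  fac₃⇒fac₄ k (snoc f i≤n pal) with PalFactor-shape pal i≤n
  ... | empty refl  = weaken (fac₃⇒fac₄ k f)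
  ... | letter refl = weaken (fac₂⇒fac₄ k f)
  ... | triple refl = ⊥-elim (distinct k (trans (pal ≤-refl (m≤n+m _ 2) (sym (+-suc (k * 4) _))) (sym (inner k))))
  ... | centred h e i<n with h ∸ k | balanced-start 3 {k = k} {h = h} e
  ... | suc j | refl = extend (fac₁⇒fac₀ j f) (block-index-≤ {r = 0} j<1+k z≤n) (widen pal first)
    where
    j<1+k : j < suc k
    j<1+k = block-index-< {ρ = 2} {r = 0} (s≤s z≤n) (≤-trans i<n (n≤1+n _))
    first : s (j * 4) ≡ s (3 + k * 4)
    first with m≤n⇒m<n∨m≡n (≤-pred j<1+k)
    ... | inj₂ refl = outer j
    ... | inj₁ j<k  = begin
      s (j * 4)      ≡⟨ outer j ⟩
      s (3 + j * 4)  ≡⟨ pal (s≤s (m≤n+m _ 2)) (block-index-≤ j<k (s≤s z≤n)) (solve (j ∷ k ∷ [])) ⟩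
      s (k * 4)      ≡⟨ outer k ⟩
      s (3 + k * 4)  ∎
      where open ≡-Reasoning

data Blocks {A : Set} : List A → Set where
  []    : Blocks []
  block : x ≢ y → Blocks w → Blocks (x ∷ y ∷ y ∷ x ∷ w)

Blocks-++ : Blocks u → Blocks v → Blocks (u ++ v)
Blocks-++ []              bv = bv
Blocks-++ (block x≢y bu) bv = block x≢y (Blocks-++ bu bv)

Blocks-map : (g : A ↔ A) → Blocks w → Blocks (map (Inverse.to g) w)
Blocks-map g []              = []
Blocks-map g (block x≢y bw) = block (λ gx≡gy → x≢y (Injection.injective (↔⇒↣ g) gx≡gy)) (Blocks-map g bw)

block-inversion : ∀ {x y y′ x′ : A} → Blocks (x ∷ y ∷ y′ ∷ x′ ∷ w) → x ≡ x′ × y ≡ y′ × x ≢ y × Blocks w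
block-inversion (block x≢y bw) = refl , refl , x≢y , bw

Blocks-segment : ∀ N → Blocks (segment s i N) → 4 + q * 4 ≤ N → IsBlock s (i + q * 4)
Blocks-segment {s = s} {i = i} {q = zero} (suc (suc (suc (suc N)))) bs _ with block-inversion bs
... | outer , inner , distinct , _ =
  subst (IsBlock s) (sym (+-identityʳ i)) (record { outer = outer ; inner = inner ; distinct = distinct })
Blocks-segment {s = s} {i = i} {q = suc q} (suc (suc (suc (suc N)))) bs (s≤s (s≤s (s≤s (s≤s le)))) with block-inversion bs
... | _ , _ , _ , rest = subst (IsBlock s) shift (Blocks-segment {q = q} N rest le)
  where
  shift : 4 + i + q * 4 ≡ i + suc q * 4
  shift = solve (i ∷ q ∷ [])

module WordSequence (a : A) (f : ℕ → A ↔ A) where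

  W : ℕ → List A
  W = wordSeq a f

  W-blocks : (∀ n → applyBij (f n) (W n) ≢ W n) → ∀ n → Blocks (W (suc n))
  W-blocks nontrivial zero    = block (λ a≡fa → nontrivial 0 (cong (_∷ []) (sym a≡fa))) []
  W-blocks nontrivial (suc n) = Blocks-++ bw (Blocks-++ (Blocks-map (f (suc n)) bw) (Blocks-++ (Blocks-map (f (suc n)) bw) bw))
    where
    bw : Blocks (W (suc n))
    bw = W-blocks nontrivial n

  length-W : ∀ n → length (W (suc n)) ≡ length (W n) * 4
  length-W n = begin
    length (W n ++ g (W n) ++ g (W n) ++ W n)                  ≡⟨ length-++ (W n) ⟩
    l + length (g (W n) ++ g (W n) ++ W n)                     ≡⟨ cong (l +_) (length-++ (g (W n))) ⟩
    l + (length (g (W n)) + length (g (W n) ++ W n))           ≡⟨ cong (λ z → l + (z + length (g (W n) ++ W n))) (length-map _ (W n)) ⟩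
    l + (l + length (g (W n) ++ W n))                          ≡⟨ cong (λ z → l + (l + z)) (length-++ (g (W n))) ⟩
    l + (l + (length (g (W n)) + l))                           ≡⟨ cong (λ z → l + (l + (z + l))) (length-map _ (W n)) ⟩
    l + (l + (l + l))                                          ≡⟨ cong (λ z → l + (l + (l + z))) (sym (+-identityʳ l)) ⟩
    4 * l                                                      ≡⟨ *-comm 4 l ⟩
    l * 4                                                      ∎
    where
    open ≡-Reasoning
    g : List A → List A
    g = applyBij (f n)
    l : ℕ
    l = length (W n)

  suc≤length-W : ∀ n → suc n ≤ length (W n)
  suc≤length-W zero    = s≤s z≤n
  suc≤length-W (suc n) = begin
    suc (suc n)        ≤⟨ s≤s (s≤s (≤-trans (m≤m*n n 4) (m≤n+m _ 2))) ⟩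
    suc n * 4          ≤⟨ *-monoˡ-≤ 4 (suc≤length-W n) ⟩
    length (W n) * 4   ≡⟨ sym (length-W n) ⟩
    length (W (suc n)) ∎
    where open ≤-Reasoning

classC⇒blocks : InClassC A s → ∀ q → IsBlock s (q * 4)
classC⇒blocks {s = s} (a , f , nontrivial , limit) q =
  Blocks-segment {q = q} N (subst Blocks (trans (sym (limit (suc q))) (prefix-segment N)) (W-blocks nontrivial q))
    (subst (suc q * 4 ≤_) (sym (length-W q)) (*-monoˡ-≤ 4 (suc≤length-W q)))
  where
  open WordSequence a f
  N : ℕ
  N = length (W (suc q))

corollary2 : (A : Set) → ∃₂ (λ (x y : A) → x ≢ y) →
    (s : ℕ → A) → InClassC A s →
    ∀ (k p0 p1 p2 p3 : ℕ) →
    IsPl s (4 * k) p0 → IsPl s (4 * k + 1) p1 →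
    IsPl s (4 * k + 2) p2 → IsPl s (4 * k + 3) p3 →
    (p3 + 1 ≤ p1) × (p3 + 1 ≤ p2) × (p3 ≤ p0)
corollary2 A _ s classC k p0 p1 p2 p3 (fac₀ , _) (fac₁ , _) (fac₂ , _) (_ , least₃) =
  p3< (fac₂⇒fac₄ k (as-Factorization fac₁ (solve (k ∷ [])))) ,
  p3< (fac₃⇒fac₄ k (as-Factorization fac₂ (solve (k ∷ [])))) ,
  p3≤p0 (fac₁⇒fac₀ k (as-Factorization fac₀ (solve (k ∷ []))))
  where
  blocks : ∀ q → IsBlock s (q * 4)
  blocks = classC⇒blocks classC
  open BlockSequence blocks

  as-Factorization : ∀ {n n′ p} → PalFactorization (prefix s n) p → n ≡ n′ → Factorization s n′ p
  as-Factorization fac refl = PalFactorization⇒Factorization fac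

  as-PalFactorization : ∀ {n n′ p} → Factorization s n p → n ≡ n′ → PalFactorization (prefix s n′) p
  as-PalFactorization g refl = Factorization⇒PalFactorization g

  p3-least : ∀ {p} → Factorization s (4 + k * 4) p → p3 ≤ p
  p3-least {p} g = least₃ p (as-PalFactorization g (solve (k ∷ [])))

  p3< : ∀ {p} → Factorization< s (4 + k * 4) p → p3 + 1 ≤ p
  p3< {p} (_ , m<p , g) = subst (_≤ p) (+-comm 1 p3) (≤-trans (s≤s (p3-least g)) m<p)

  p3≤p0 : Factorization< s (k * 4) p0 → p3 ≤ p0
  p3≤p0 (_ , m<p0 , g) = ≤-trans (p3-least (snoc g (m≤n+m _ 4) (IsBlock⇒PalFactor (blocks k)))) m<p0
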